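{- Let $[6,00,01]$ be the two-vertex Boolean network $f_1=x_1\land x_2$, $f_2=x_1\oplus x_2$, and $[7,00,01]$ the network $f_1=x_1\land\neg x_2$, $f_2=x_1\oplus x_2$. For each of these two networks there exist delay vectors $(\alpha,\beta)$ such that the MBN built on it with these delays admits a limit cycle.
   Context: The MBN built on a two-vertex Boolean network $(f_1,f_2)$ with delay vector $(\alpha,\beta)$ of positive integers has configurations $(\rho,\gamma)$ with $0\le\rho\le\alpha$, $0\le\gamma\le\beta$, underlying Boolean state $x=([\rho\ge1],[\gamma\ge1])$, and dynamics: the first coordinate becomes $\alpha$ if $f_1(x)=1$, else $\max(\rho-1,0)$; the second becomes $\beta$ if $f_2(x)=1$, else $\max(\gamma-1,0)$. A limit cycle is a periodic orbit of length $\ge2$. $\oplus$ is exclusive or. -}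

module Defs where

open import Data.Bool using (Bool; true; false; _∧_; _xor_; not)
open import Data.Nat using (ℕ; zero; suc; _≤_; _<_; _∸_; pred)
open import Data.Product using (_×_; _,_; Σ; proj₁; proj₂)
open import Relation.Binary.PropositionalEquality using (_≡_)
open import Relation.Nullary using (¬_)

BN2 : Set
BN2 = (Bool → Bool → Bool) × (Bool → Bool → Bool)

net6 : BN2
net6 = (λ x₁ x₂ → x₁ ∧ x₂) , (λ x₁ x₂ → x₁ xor x₂)

net7 : BN2
net7 = (λ x₁ x₂ → x₁ ∧ not x₂) , (λ x₁ x₂ → x₁ xor x₂)

pos : ℕ → Bool
pos zero = false
pos (suc _) = true

Config : Set
Config = ℕ × ℕ

Valid : ℕ → ℕ → Config → Set
Valid α β (ρ , γ) = (ρ ≤ α) × (γ ≤ β)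

-- one MBN step; note max(n-1,0) = n ∸ 1 on ℕ
mbnStep : BN2 → ℕ → ℕ → Config → Config
mbnStep (f₁ , f₂) α β (ρ , γ) =
  upd (f₁ (pos ρ) (pos γ)) α ρ , upd (f₂ (pos ρ) (pos γ)) β γ
  where
    upd : Bool → ℕ → ℕ → ℕ
    upd true  d _ = d
    upd false _ n = n ∸ 1

iterate : (Config → Config) → ℕ → Config → Config
iterate F zero c = c
iterate F (suc k) c = F (iterate F k c)

PeriodicOrbit : (Config → Config) → Config → ℕ → Set
PeriodicOrbit F c p =
  (0 < p) × (iterate F p c ≡ c) × (∀ k → 0 < k → k < p → ¬ (iterate F k c ≡ c))

HasLimitCycle : BN2 → ℕ → ℕ → Set
HasLimitCycle f α β =
  Σ Config λ c → Σ ℕ λ p →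
    Valid α β c × (2 ≤ p) × PeriodicOrbit (mbnStep f α β) c p

{-# OPTIONS --safe #-}
module Submission where

open import Defs
open import Data.Nat using (ℕ; zero; suc; _≤_; _<_; z≤n; s≤s)
open import Data.Nat.Properties using (≤-refl)
open import Data.Product using (_×_; Σ; _,_)
open import Relation.Binary.PropositionalEquality using (_≡_; refl)
open import Relation.Nullary using (¬_)

-- Both networks have a 2-cycle for delays (2 , 1):
--   [6,00,01] : (1,1) ↦ (2,0) ↦ (1,1),
--   [7,00,01] : (1,0) ↦ (2,1) ↦ (1,0).

twoCycle⇒periodicOrbit : ∀ (F : Config → Config) c →
  ¬ (F c ≡ c) → F (F c) ≡ c → PeriodicOrbit F c 2
twoCycle⇒periodicOrbit F c Fc≢c FFc≡c = s≤s z≤n , FFc≡c , notEarlier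
  where
  notEarlier : ∀ k → 0 < k → k < 2 → ¬ (iterate F k c ≡ c)
  notEarlier (suc zero) _ _ = Fc≢c
  notEarlier (suc (suc _)) _ (s≤s (s≤s ()))

twoCycle⇒hasLimitCycle : ∀ f α β c → Valid α β c →
  ¬ (mbnStep f α β c ≡ c) → mbnStep f α β (mbnStep f α β c) ≡ c →
  HasLimitCycle f α β
twoCycle⇒hasLimitCycle f α β c valid Fc≢c FFc≡c =
  c , 2 , valid , ≤-refl , twoCycle⇒periodicOrbit (mbnStep f α β) c Fc≢c FFc≡c

net6-limitCycle : HasLimitCycle net6 2 1
net6-limitCycle = twoCycle⇒hasLimitCycle net6 2 1 (1 , 1) (s≤s z≤n , s≤s z≤n) (λ ()) refl

net7-limitCycle : HasLimitCycle net7 2 1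
net7-limitCycle = twoCycle⇒hasLimitCycle net7 2 1 (1 , 0) (s≤s z≤n , z≤n) (λ ()) refl

proposition10 : (Σ ℕ λ α → Σ ℕ λ β → (1 ≤ α) × (1 ≤ β) × HasLimitCycle net6 α β)
    × (Σ ℕ λ α → Σ ℕ λ β → (1 ≤ α) × (1 ≤ β) × HasLimitCycle net7 α β)
proposition10 =
    (2 , 1 , s≤s z≤n , s≤s z≤n , net6-limitCycle)
  , (2 , 1 , s≤s z≤n , s≤s z≤n , net7-limitCycle)
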